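{- Let $L=(1^+0^+)^\omega\subseteq\{0,1\}^\omega$, let $E_1\subseteq[L]^2$ consist of all 2-sets $\{x,y\}\subseteq L$ such that ${\mathrm{supp}}(x)\cap{\mathrm{supp}}(y)$ is finite or $x\sim_e y$, and let $E_2=[L]^2\setminus E_1$. Let $H\subseteq L$ with $H\in\mathrm{LANG}^*$ and $|H|=\lambda>\aleph_0$. Then $H$ is not homogeneous in the $(2,2)$-partition $(L,E_1,E_2)$, i.e., neither $[H]^2\subseteq E_1$ nor $[H]^2\subseteq E_2$.
   Context: $[L]^2$ is the set of 2-element subsets of $L$. For $x\in\{0,1\}^\omega$, ${\mathrm{supp}}(x)\subseteq\mathbb N$ is the set of positions of the letter $1$ in $x$. Two $\omega$-words $x,y$ are ultimately equal, $x\sim_e y$, if there is $i\in\mathbb N$ with $x[i,\omega)=y[i,\omega)$ (the suffixes from position $i$ coincide). $\mathrm{LANG}^*$ is the class of $\omega$-languages of the form $\bigcup_{1\le i\le n}U_iV_i^\omega$ with $U_i,V_i$ arbitrary languages of finite words (for $V\subseteq\{0,1\}^+$, $V^\omega$ is the set of $\omega$-words $v_0v_1v_2\cdots$ with $v_i\in V$). -}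

module Defs where

open import Data.Nat using (ℕ; zero; suc; _≤_; _<_; _∸_)
open import Data.Bool using (Bool; true; false)
open import Data.List using (List; []; _∷_; _++_; replicate)
open import Data.Fin using (Fin)
open import Data.Product using (Σ; ∃; _×_; _,_)
open import Data.Sum using (_⊎_)
open import Relation.Nullary using (¬_)
open import Relation.Binary.PropositionalEquality using (_≡_)

-- ω-words over {0,1}, with false = 0 and true = 1
Word : Set
Word = ℕ → Bool

Lang : Set₁
Lang = List Bool → Set

_≈w_ : Word → Word → Set
x ≈w y = ∀ n → x n ≡ y n

seg : Word → ℕ → ℕ → List Bool
seg x a zero    = []
seg x a (suc k) = x a ∷ seg x (suc a) k

_⋯_ : List Bool → Word → Word
([]    ⋯ y) n       = y n
((b ∷ u) ⋯ y) zero    = b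
((b ∷ u) ⋯ y) (suc n) = (u ⋯ y) n

-- V^ω : x = v₀ v₁ v₂ ⋯ with every vᵢ ∈ V nonempty; the cut points
-- p 0 = 0 < p 1 < p 2 < ⋯ and vᵢ = x[p i, p (i+1))
OmegaPow : Lang → Word → Set
OmegaPow V x =
  Σ (ℕ → ℕ) λ p → (p 0 ≡ 0) × (∀ i → p i < p (suc i))
                  × (∀ i → V (seg x (p i) (p (suc i) ∸ p i)))

ConcOmega : Lang → Lang → Word → Set
ConcOmega U V x = Σ (List Bool) λ u → U u × Σ Word λ y → OmegaPow V y × (x ≈w (u ⋯ y))

LANGstar : (Word → Set) → Set₁
LANGstar H = Σ ℕ λ n → Σ (Fin n → Lang) λ U → Σ (Fin n → Lang) λ V →
  ∀ x → (H x → Σ (Fin n) λ i → ConcOmega (U i) (V i) x)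
      × ((Σ (Fin n) λ i → ConcOmega (U i) (V i) x) → H x)

OnesZeros : Lang
OnesZeros w = Σ ℕ λ m → Σ ℕ λ k → w ≡ replicate (suc m) true ++ replicate (suc k) false

L : Word → Set
L = OmegaPow OnesZeros

-- supp(x) ∩ supp(y) is finite (bounded)
FiniteSuppInter : Word → Word → Set
FiniteSuppInter x y = Σ ℕ λ N → ∀ n → N ≤ n → x n ≡ true → y n ≡ false

UltEq : Word → Word → Set
UltEq x y = Σ ℕ λ i → ∀ n → i ≤ n → x n ≡ y n

E1 : Word → Word → Set
E1 x y = FiniteSuppInter x y ⊎ UltEq x y

E2 : Word → Word → Set
E2 x y = ¬ E1 x y

-- [H]² ⊆ E  (2-sets = pairs of distinct words)
TwoSetsIn : (Word → Set) → (Word → Word → Set) → Set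
TwoSetsIn H E = ∀ x y → H x → H y → ¬ (x ≈w y) → E x y

Uncountable : (Word → Set) → Set
Uncountable H = ¬ (Σ (ℕ → Word) λ f → ∀ x → H x → Σ ℕ λ n → x ≈w f n)

-- Write H = ⋃ᵢ Uᵢ Vᵢ^ω. If in every component with Uᵢ ≠ ∅ all words of Vᵢ have
-- the same ω-power α, then every element of Uᵢ Vᵢ^ω is of the form u α, so H is
-- countable. Otherwise some component has u ∈ Uᵢ and v, w ∈ Vᵢ with v^ω ≠ w^ω.
-- Then u v^ω and u (vw)^ω lie in H, are periodic with a common period, and are
-- not ultimately equal, yet share infinitely many 1s (v^ω contains a 1, as
-- u v^ω ∈ L, and a 1 of v^ω inside v recurs in (vw)^ω); so [H]² ⊈ E₁.
-- And u v w v^ω ≠ u w v v^ω lie in H and are ultimately equal, so [H]² ⊈ E₂.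
module Submission where

open import Defs
open import Data.Bool using (Bool; true; false)
open import Data.Bool.Properties using () renaming (_≟_ to _≟ᵇ_)
open import Data.Empty using (⊥-elim)
open import Function using (_∘_)
open import Data.Fin using (Fin)
open import Data.List using (List; []; _∷_; _++_; length)
open import Data.List.Properties using (length-++; length-++-comm)
open import Data.Nat using (ℕ; zero; suc; _+_; _*_; _∸_; _≤_; _<_; _<?_; z≤n; s≤s; NonZero)
open import Data.Nat.Binary using (ℕᵇ; 2[1+_]; 1+[2_]) renaming (zero to 0ᵇ; toℕ to toℕᵇ; fromℕ to fromℕᵇ)
open import Data.Nat.Binary.Properties using (fromℕ-toℕ)
open import Data.Nat.DivMod using (_%_; _/_; m≡m%n+[m/n]*n; m%n<n)
open import Data.Nat.Induction using (<-rec)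
open import Data.Nat.Properties using (+-assoc; +-comm; +-suc; +-identityʳ; *-comm; ≤-trans; <⇒≤; <⇒≱; ≮⇒≥; m≤m+n; m≤n+m; m<m+n; m<n+m; m≤m*n; m+n∸m≡n; m+[n∸m]≡n; m<n⇒0<n∸m; m≤n⇒∃[o]m+o≡n)
open import Data.Product using (Σ; ∃; _×_; _,_; proj₁; proj₂)
open import Data.Sum using (_⊎_; inj₁; inj₂; [_,_])
open import Relation.Nullary using (¬_; yes; no)
open import Relation.Binary.PropositionalEquality using (_≡_; _≢_; refl; sym; trans; cong; cong₂; subst; module ≡-Reasoning)
open ≡-Reasoning

suffix : ℕ → Word → Word
suffix a x n = x (a + n)

⋯-cong : ∀ l {z z'} → z ≈w z' → (l ⋯ z) ≈w (l ⋯ z')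
⋯-cong []      e n       = e n
⋯-cong (b ∷ l) e zero    = refl
⋯-cong (b ∷ l) e (suc n) = ⋯-cong l e n

⋯-++ : ∀ l l' z → ((l ++ l') ⋯ z) ≈w (l ⋯ (l' ⋯ z))
⋯-++ []      l' z n       = refl
⋯-++ (b ∷ l) l' z zero    = refl
⋯-++ (b ∷ l) l' z (suc n) = ⋯-++ l l' z n

⋯-beyond : ∀ l z m → (l ⋯ z) (length l + m) ≡ z m
⋯-beyond []      z m = refl
⋯-beyond (b ∷ l) z m = ⋯-beyond l z m

⋯-inside : ∀ l z z' {n} → n < length l → (l ⋯ z) n ≡ (l ⋯ z') n
⋯-inside (b ∷ l) z z' {zero}  _         = refl
⋯-inside (b ∷ l) z z' {suc n} (s≤s n<l) = ⋯-inside l z z' n<l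

⋯-cancelˡ : ∀ l {z z'} → (l ⋯ z) ≈w (l ⋯ z') → z ≈w z'
⋯-cancelˡ l {z} {z'} e m = trans (sym (⋯-beyond l z m)) (trans (e _) (⋯-beyond l z' m))

data PrefixView (l : List Bool) : ℕ → Set where
  inside : ∀ {n} → n < length l → PrefixView l n
  beyond : ∀ m → PrefixView l (length l + m)

prefixView : ∀ l n → PrefixView l n
prefixView l n with n <? length l
... | yes n<l = inside n<l
... | no n≮l  = let m , l+m≡n = m≤n⇒∃[o]m+o≡n (≮⇒≥ n≮l) in subst (PrefixView l) l+m≡n (beyond m)

seg-suffix : ∀ x a b k → seg x (a + b) k ≡ seg (suffix a x) b k
seg-suffix x a b zero    = refl
seg-suffix x a b (suc k) =
  cong (x (a + b) ∷_) (trans (cong (λ c → seg x c k) (sym (+-suc a b))) (seg-suffix x a (suc b) k))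

seg-cong : ∀ {x y} → x ≈w y → ∀ a k → seg x a k ≡ seg y a k
seg-cong e a zero    = refl
seg-cong e a (suc k) = cong₂ _∷_ (e a) (seg-cong e (suc a) k)

seg-⋯ : ∀ l z → seg (l ⋯ z) 0 (length l) ≡ l
seg-⋯ []      z = refl
seg-⋯ (b ∷ l) z = cong (b ∷_) (trans (seg-suffix ((b ∷ l) ⋯ z) 1 0 (length l)) (seg-⋯ l z))

suffix-seg : ∀ y a k → suffix a y ≈w (seg y a k ⋯ suffix (a + k) y)
suffix-seg y a zero    n       = cong (λ c → y (c + n)) (sym (+-identityʳ a))
suffix-seg y a (suc k) zero    = cong y (+-identityʳ a)
suffix-seg y a (suc k) (suc n) = begin
  y (a + suc n)                                ≡⟨ cong y (+-suc a n) ⟩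
  y (suc a + n)                                ≡⟨ suffix-seg y (suc a) k n ⟩
  (seg y (suc a) k ⋯ suffix (suc a + k) y) n   ≡⟨ cong (λ c → (seg y (suc a) k ⋯ suffix c y) n) (+-suc a k) ⟨
  (seg y (suc a) k ⋯ suffix (a + suc k) y) n   ∎

-- A nonempty finite word is represented as h ∷ t; cycleFrom h t c r is (c ∷ r) (h ∷ t)^ω.

cycleFrom : Bool → List Bool → Bool → List Bool → Word
cycleFrom h t c r       zero    = c
cycleFrom h t c []      (suc n) = cycleFrom h t h t n
cycleFrom h t c (d ∷ r) (suc n) = cycleFrom h t d r n

cycle : Bool → List Bool → Word
cycle h t = cycleFrom h t h t

cycleFrom-unfold : ∀ h t c r → cycleFrom h t c r ≈w ((c ∷ r) ⋯ cycle h t)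
cycleFrom-unfold h t c r       zero    = refl
cycleFrom-unfold h t c []      (suc n) = refl
cycleFrom-unfold h t c (d ∷ r) (suc n) = cycleFrom-unfold h t d r n

cycle-unfold : ∀ h t → cycle h t ≈w ((h ∷ t) ⋯ cycle h t)
cycle-unfold h t = cycleFrom-unfold h t h t

Periodic : ℕ → Word → Set
Periodic P x = ∀ n → x (P + n) ≡ x n

fixpoint-periodic : ∀ l {x} → x ≈w (l ⋯ x) → Periodic (length l) x
fixpoint-periodic l {x} e n = trans (e _) (⋯-beyond l x n)

cycle-periodic : ∀ h t → Periodic (length (h ∷ t)) (cycle h t)
cycle-periodic h t = fixpoint-periodic (h ∷ t) (cycle-unfold h t)

periodic-*ˡ : ∀ {P x} → Periodic P x → ∀ k → Periodic (k * P) x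
periodic-*ˡ         per zero    n = refl
periodic-*ˡ {P} {x} per (suc k) n =
  trans (cong x (+-assoc P (k * P) n)) (trans (per _) (periodic-*ˡ per k n))

periodic-*ʳ : ∀ {P x} → Periodic P x → ∀ k → Periodic (P * k) x
periodic-*ʳ {P} {x} per k = subst (λ Q → Periodic Q x) (*-comm k P) (periodic-*ˡ per k)

periodic-% : ∀ {P x} .{{_ : NonZero P}} → Periodic P x → ∀ n → x n ≡ x (n % P)
periodic-% {P} {x} per n = begin
  x n                   ≡⟨ cong x (m≡m%n+[m/n]*n n P) ⟩
  x (n % P + n / P * P) ≡⟨ cong x (+-comm (n % P) _) ⟩
  x (n / P * P + n % P) ≡⟨ periodic-*ˡ per (n / P) (n % P) ⟩
  x (n % P)             ∎

fixpoint-unique : ∀ h t {z z'} → z ≈w ((h ∷ t) ⋯ z) → z' ≈w ((h ∷ t) ⋯ z') → z ≈w z'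
fixpoint-unique h t {z} {z'} e e' n = begin
  z n                ≡⟨ periodic-% (fixpoint-periodic (h ∷ t) e) n ⟩
  z r                ≡⟨ e r ⟩
  ((h ∷ t) ⋯ z) r    ≡⟨ ⋯-inside (h ∷ t) z z' (m%n<n n (length (h ∷ t))) ⟩
  ((h ∷ t) ⋯ z') r   ≡⟨ e' r ⟨
  z' r               ≡⟨ periodic-% (fixpoint-periodic (h ∷ t) e') n ⟨
  z' n               ∎
  where r = n % length (h ∷ t)

periodic-ultEq⇒≈ : ∀ {P x y} .{{_ : NonZero P}} → Periodic P x → Periodic P y → UltEq x y → x ≈w y
periodic-ultEq⇒≈ {P} {x} {y} px py (N , agree) n = begin
  x n           ≡⟨ periodic-*ˡ px N n ⟨
  x (N * P + n) ≡⟨ agree _ (≤-trans (m≤m*n N P) (m≤m+n _ n)) ⟩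
  y (N * P + n) ≡⟨ periodic-*ˡ py N n ⟩
  y n           ∎

periodic-sharedOne : ∀ {P x y} .{{_ : NonZero P}} → Periodic P x → Periodic P y →
                     ∀ j → x j ≡ true → y j ≡ true → ¬ FiniteSuppInter x y
periodic-sharedOne {P} px py j xj yj (N , disjoint)
  with () ← trans (sym (trans (periodic-*ˡ py N j) yj))
                  (disjoint _ (≤-trans (m≤m*n N P) (m≤m+n _ j)) (trans (periodic-*ˡ px N j) xj))

ultEq-⋯⁻ : ∀ u {x y} → UltEq (u ⋯ x) (u ⋯ y) → UltEq x y
ultEq-⋯⁻ u {x} {y} (N , agree) = N , λ n N≤n →
  trans (sym (⋯-beyond u x n)) (trans (agree _ (≤-trans N≤n (m≤n+m n _))) (⋯-beyond u y n))

finiteSuppInter-⋯⁻ : ∀ u {x y} → FiniteSuppInter (u ⋯ x) (u ⋯ y) → FiniteSuppInter x y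
finiteSuppInter-⋯⁻ u {x} {y} (N , disjoint) = N , λ n N≤n xn →
  trans (sym (⋯-beyond u y n)) (disjoint _ (≤-trans N≤n (m≤n+m n _)) (trans (⋯-beyond u x n) xn))

ultEq-⋯ : ∀ l l' z → length l ≡ length l' → UltEq (l ⋯ z) (l' ⋯ z)
ultEq-⋯ l l' z |l|≡|l'| = length l , agree
  where
  agree : ∀ n → length l ≤ n → (l ⋯ z) n ≡ (l' ⋯ z) n
  agree n l≤n with prefixView l n
  ... | inside n<l = ⊥-elim (<⇒≱ n<l l≤n)
  ... | beyond m   = begin
    (l ⋯ z) (length l + m)   ≡⟨ ⋯-beyond l z m ⟩
    z m                      ≡⟨ ⋯-beyond l' z m ⟨
    (l' ⋯ z) (length l' + m) ≡⟨ cong (λ c → (l' ⋯ z) (c + m)) |l|≡|l'| ⟨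
    (l' ⋯ z) (length l + m)  ∎

-- Unfolds V Q says Q ⊆ (V ∖ {ε}) Q; V^ω is the largest such Q.

record Unfolding (V : Lang) (Q : Word → Set) (z : Word) : Set where
  constructor unfolded
  field
    {hd}    : Bool
    {tl}    : List Bool
    block∈V : V (hd ∷ tl)
    {rest}  : Word
    rest∈Q  : Q rest
    unfold  : z ≈w ((hd ∷ tl) ⋯ rest)

unfolding-map : ∀ {V Q Q' z} → (∀ {x} → Q x → Q' x) → Unfolding V Q z → Unfolding V Q' z
unfolding-map f (unfolded v q z≈) = unfolded v (f q) z≈

Unfolds : Lang → (Word → Set) → Set
Unfolds V Q = ∀ {z} → Q z → Unfolding V Q z

module _ {V : Lang} {Q : Word → Set} (unf : Unfolds V Q) where
  open Unfolding

  private
    State : Set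
    State = Σ Word Q

    next : State → State
    next (_ , q) = rest (unf q) , rest∈Q (unf q)

    block : State → List Bool
    block (_ , q) = hd (unf q) ∷ tl (unf q)

  unfolds⇒omegaPow : ∀ {z} → Q z → OmegaPow V z
  unfolds⇒omegaPow {z} q = cut , refl , (λ i → m<m+n (cut i) (s≤s z≤n)) , block∈V-at
    where
    state : ℕ → State
    state zero    = z , q
    state (suc i) = next (state i)

    cut : ℕ → ℕ
    cut zero    = 0
    cut (suc i) = cut i + length (block (state i))

    suffix-state : ∀ i → suffix (cut i) z ≈w proj₁ (state i)
    suffix-state zero    n = refl
    suffix-state (suc i) n = begin
      z (cut i + ℓ + n)             ≡⟨ cong z (+-assoc (cut i) ℓ n) ⟩
      z (cut i + (ℓ + n))           ≡⟨ suffix-state i (ℓ + n) ⟩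
      proj₁ (state i) (ℓ + n)       ≡⟨ unfold (unf (proj₂ (state i))) (ℓ + n) ⟩
      (block (state i) ⋯ _) (ℓ + n) ≡⟨ ⋯-beyond (block (state i)) _ n ⟩
      proj₁ (state (suc i)) n       ∎
      where ℓ = length (block (state i))

    block∈V-at : ∀ i → V (seg z (cut i) (cut (suc i) ∸ cut i))
    block∈V-at i = subst V (sym seg≡block) (block∈V (unf (proj₂ (state i))))
      where
      ℓ = length (block (state i))
      seg≡block : seg z (cut i) (cut (suc i) ∸ cut i) ≡ block (state i)
      seg≡block = begin
        seg z (cut i) (cut i + ℓ ∸ cut i)       ≡⟨ cong (seg z (cut i)) (m+n∸m≡n (cut i) ℓ) ⟩
        seg z (cut i) ℓ                         ≡⟨ cong (λ c → seg z c ℓ) (+-identityʳ (cut i)) ⟨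
        seg z (cut i + 0) ℓ                     ≡⟨ seg-suffix z (cut i) 0 ℓ ⟩
        seg (suffix (cut i) z) 0 ℓ              ≡⟨ seg-cong (suffix-state i) 0 ℓ ⟩
        seg (proj₁ (state i)) 0 ℓ               ≡⟨ seg-cong (unfold (unf (proj₂ (state i)))) 0 ℓ ⟩
        seg (block (state i) ⋯ _) 0 ℓ           ≡⟨ seg-⋯ (block (state i)) _ ⟩
        block (state i)                         ∎

CutSuffix : Lang → Word → Set
CutSuffix V z = Σ Word λ y → Σ (OmegaPow V y) λ y∈Vω → Σ ℕ λ j → z ≈w suffix (proj₁ y∈Vω j) y

cutSuffix-unfolds : ∀ {V} → Unfolds V (CutSuffix V)
cutSuffix-unfolds {V} {z} (y , y∈Vω@(p , _ , p< , blocks) , j , z≈)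
  with p (suc j) ∸ p j | m<n⇒0<n∸m (p< j) | blocks j | m+[n∸m]≡n (<⇒≤ (p< j))
... | suc k | _ | block∈V | p+k≡p′ = unfolded block∈V (y , y∈Vω , suc j , λ _ → refl) z≈block⋯rest
  where
  z≈block⋯rest : z ≈w (seg y (p j) (suc k) ⋯ suffix (p (suc j)) y)
  z≈block⋯rest n = trans (z≈ n) (trans (suffix-seg y (p j) (suc k) n)
                     (cong (λ c → (seg y (p j) (suc k) ⋯ suffix c y) n) p+k≡p′))

omegaPow-unfolds : ∀ {V} → Unfolds V (OmegaPow V)
omegaPow-unfolds {V} {z} z∈Vω@(_ , p0 , _ , _) =
  unfolding-map (unfolds⇒omegaPow (cutSuffix-unfolds {V}))
    (cutSuffix-unfolds {V} (z , z∈Vω , 0 , λ n → cong (λ c → z (c + n)) (sym p0)))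

unfolds-constant : ∀ {V Q α} → Unfolds V Q → (∀ {h t} → V (h ∷ t) → cycle h t ≈w α) →
                   ∀ {z} → Q z → z ≈w α
unfolds-constant {V} {Q} {α} unf agree q n = <-rec Goal go n q
  where
  Goal : ℕ → Set
  Goal n = ∀ {z} → Q z → z n ≡ α n

  go : ∀ n → (∀ {m} → m < n → Goal m) → Goal n
  go n rec {z} q with unf q
  ... | unfolded {h} {t} v {z'} q' z≈ with prefixView (h ∷ t) n
  ...   | inside n<ℓ = begin
    z n                    ≡⟨ z≈ n ⟩
    ((h ∷ t) ⋯ z') n       ≡⟨ ⋯-inside (h ∷ t) z' (cycle h t) n<ℓ ⟩
    ((h ∷ t) ⋯ cycle h t) n ≡⟨ cycle-unfold h t n ⟨
    cycle h t n            ≡⟨ agree v n ⟩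
    α n                    ∎
  ...   | beyond m = begin
    z (ℓ + m)              ≡⟨ z≈ _ ⟩
    ((h ∷ t) ⋯ z') (ℓ + m) ≡⟨ ⋯-beyond (h ∷ t) z' m ⟩
    z' m                   ≡⟨ rec (m<n+m m (s≤s z≤n)) q' ⟩
    α m                    ≡⟨ agree v m ⟨
    cycle h t m            ≡⟨ cycle-periodic h t m ⟨
    cycle h t (ℓ + m)      ≡⟨ agree v _ ⟩
    α (ℓ + m)              ∎
    where ℓ = length (h ∷ t)

omegaPow-cycle : ∀ {V h t} → V (h ∷ t) → OmegaPow V (cycle h t)
omegaPow-cycle {V} {h} {t} v = unfolds⇒omegaPow unf (λ _ → refl)
  where
  unf : Unfolds V (_≈w cycle h t)
  unf z≈ = unfolded v (λ _ → refl) (λ n → trans (z≈ n) (cycle-unfold h t n))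

omegaPow-cycle++ : ∀ {V h t h' t'} → V (h ∷ t) → V (h' ∷ t') → OmegaPow V (cycle h (t ++ h' ∷ t'))
omegaPow-cycle++ {V} {h} {t} {h'} {t'} v v' = unfolds⇒omegaPow unf (inj₁ (λ _ → refl))
  where
  γ = cycle h (t ++ h' ∷ t')

  unf : Unfolds V (λ z → z ≈w γ ⊎ z ≈w ((h' ∷ t') ⋯ γ))
  unf (inj₁ z≈) = unfolded v (inj₂ (λ _ → refl))
    (λ n → trans (z≈ n) (trans (cycle-unfold h _ n) (⋯-++ (h ∷ t) (h' ∷ t') γ n)))
  unf (inj₂ z≈) = unfolded v' (inj₁ (λ _ → refl)) z≈

omegaPow-⋯ : ∀ {V h t z} → V (h ∷ t) → OmegaPow V z → OmegaPow V ((h ∷ t) ⋯ z)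
omegaPow-⋯ {V} {h} {t} {z} v z∈Vω = unfolds⇒omegaPow unf (inj₁ (λ _ → refl))
  where
  unf : Unfolds V (λ x → x ≈w ((h ∷ t) ⋯ z) ⊎ OmegaPow V x)
  unf (inj₁ x≈) = unfolded v (inj₂ z∈Vω) x≈
  unf (inj₂ x∈Vω) = unfolding-map inj₂ (omegaPow-unfolds {V} x∈Vω)

L-onesUnbounded : ∀ {x} → L x → ∀ N → ∃ λ n → N ≤ n × x n ≡ true
L-onesUnbounded x∈L = onesUnbounded (omegaPow-unfolds {OnesZeros} x∈L)
  where
  onesUnbounded : ∀ {x} → Unfolding OnesZeros L x → ∀ N → ∃ λ n → N ≤ n × x n ≡ true
  onesUnbounded (unfolded (_ , _ , refl) _ x≈) zero = 0 , z≤n , x≈ 0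
  onesUnbounded (unfolded {h} {t} _ {r} r∈L x≈) (suc N) with L-onesUnbounded r∈L N
  ... | n , N≤n , rn = suc (length t) + n , s≤s (≤-trans N≤n (m≤n+m n _)) ,
                       trans (x≈ _) (trans (⋯-beyond (h ∷ t) r n) rn)

one-beyond-prefix : ∀ u {z} → (∃ λ n → length u ≤ n × (u ⋯ z) n ≡ true) → ∃ λ k → z k ≡ true
one-beyond-prefix u {z} (n , u≤n , un) with prefixView u n
... | inside n<u = ⊥-elim (<⇒≱ n<u u≤n)
... | beyond k   = k , trans (sym (⋯-beyond u z k)) un

Enumerable : (Word → Set) → Set
Enumerable H = Σ (ℕ → Word) λ f → ∀ x → H x → Σ ℕ λ N → x ≈w f N

bits : ℕᵇ → List Bool
bits 0ᵇ       = []
bits 2[1+ x ] = false ∷ bits x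
bits 1+[2 x ] = true ∷ bits x

fromBits : List Bool → ℕᵇ
fromBits []          = 0ᵇ
fromBits (false ∷ l) = 2[1+ fromBits l ]
fromBits (true ∷ l)  = 1+[2 fromBits l ]

bits-fromBits : ∀ l → bits (fromBits l) ≡ l
bits-fromBits []          = refl
bits-fromBits (false ∷ l) = cong (false ∷_) (bits-fromBits l)
bits-fromBits (true ∷ l)  = cong (true ∷_) (bits-fromBits l)

bits-surjective : ∀ l → Σ ℕ λ N → bits (fromℕᵇ N) ≡ l
bits-surjective l = toℕᵇ (fromBits l) , trans (cong bits (fromℕ-toℕ (fromBits l))) (bits-fromBits l)

-- A letter b of the prefix is coded as 1b, and 0 announces the period.
encode : List Bool → Bool → List Bool → List Bool
encode []      h t = false ∷ h ∷ t
encode (b ∷ u) h t = true ∷ b ∷ encode u h t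

decode : List Bool → Word
decode (true ∷ b ∷ r) zero    = b
decode (true ∷ b ∷ r) (suc n) = decode r n
decode (false ∷ h ∷ t) n      = cycle h t n
decode _              n       = false

decode-encode : ∀ u h t → decode (encode u h t) ≈w (u ⋯ cycle h t)
decode-encode []      h t n       = refl
decode-encode (b ∷ u) h t zero    = refl
decode-encode (b ∷ u) h t (suc n) = decode-encode u h t n

prefixedCycles-enumerated : ∀ u h t → Σ ℕ λ N → (u ⋯ cycle h t) ≈w decode (bits (fromℕᵇ N))
prefixedCycles-enumerated u h t with bits-surjective (encode u h t)
... | N , bits≡ = N , λ n → sym (trans (cong (λ l → decode l n) bits≡) (decode-encode u h t n))

record Nondegenerate (U V : Lang) : Set where
  constructor nondegenerate
  field
    {u}           : List Bool
    u∈U           : U u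
    {a₀ b₀}       : Bool
    {a b}         : List Bool
    a∈V           : V (a₀ ∷ a)
    b∈V           : V (b₀ ∷ b)
    {m}           : ℕ
    cycles-differ : cycle a₀ a m ≢ cycle b₀ b m

degenerate⇒cyclesAgree : ∀ {U V u h t h' t'} → ¬ Nondegenerate U V → U u →
                         V (h ∷ t) → V (h' ∷ t') → cycle h t ≈w cycle h' t'
degenerate⇒cyclesAgree {h = h} {t} {h'} {t'} deg u∈U v v' n with cycle h t n ≟ᵇ cycle h' t' n
... | yes eq  = eq
... | no  neq = ⊥-elim (deg (nondegenerate u∈U v v' {m = n} neq))

degenerate⇒prefixedCycle : ∀ {U V x} → ¬ Nondegenerate U V → ConcOmega U V x →
                           ∃ λ u → ∃ λ h → ∃ λ t → x ≈w (u ⋯ cycle h t)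
degenerate⇒prefixedCycle {U} {V} deg (u , u∈U , y , y∈Vω , x≈) = u , hd , tl , λ n → trans (x≈ n) (⋯-cong u y≈ n)
  where
  open Unfolding (omegaPow-unfolds {V} y∈Vω)

  y≈ : y ≈w cycle hd tl
  y≈ = unfolds-constant (omegaPow-unfolds {V}) (λ v' → degenerate⇒cyclesAgree deg u∈U v' block∈V) y∈Vω

degenerate⇒enumerable : ∀ {H : Word → Set} {n} {U V : Fin n → Lang} →
                        (∀ x → H x → Σ (Fin n) λ i → ConcOmega (U i) (V i) x) →
                        (∀ i → ¬ Nondegenerate (U i) (V i)) → Enumerable H
degenerate⇒enumerable H⊆⋃ deg = (λ N → decode (bits (fromℕᵇ N))) , λ x x∈H →
  let i , x∈UVω = H⊆⋃ x x∈H
      u , h , t , x≈ = degenerate⇒prefixedCycle (deg i) x∈UVω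
      N , enum = prefixedCycles-enumerated u h t
  in N , λ n → trans (x≈ n) (enum n)

module _ {U V : Lang} {H : Word → Set} (U⋯Vω⊆H : ∀ {x} → ConcOmega U V x → H x)
         (nd : Nondegenerate U V) where
  open Nondegenerate nd

  private
    v w : List Bool
    v = a₀ ∷ a
    w = b₀ ∷ b

    α γ : Word
    α = cycle a₀ a
    γ = cycle a₀ (a ++ w)

    ∈H : ∀ {x z} → OmegaPow V z → x ≈w (u ⋯ z) → H x
    ∈H z∈Vω x≈ = U⋯Vω⊆H (u , u∈U , _ , z∈Vω , x≈)

    ¬α≈w⋯α : ¬ α ≈w (w ⋯ α)
    ¬α≈w⋯α α≈ = cycles-differ (fixpoint-unique b₀ b α≈ (cycle-unfold b₀ b) m)

  ¬E1-homogeneous : (∀ x → H x → L x) → ¬ TwoSetsIn H E1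
  ¬E1-homogeneous H⊆L hom = [ ¬finite , ¬ultEq ] (hom (u ⋯ α) (u ⋯ γ) x∈H y∈H (λ e → ¬ultEq (0 , λ n _ → e n)))
    where
    x∈H : H (u ⋯ α)
    x∈H = ∈H (omegaPow-cycle {V} a∈V) (λ _ → refl)

    y∈H : H (u ⋯ γ)
    y∈H = ∈H (omegaPow-cycle++ {V} a∈V b∈V) (λ _ → refl)

    P : ℕ
    P = length (v ++ w) * length v

    α-periodic : Periodic P α
    α-periodic = periodic-*ˡ {length v} (cycle-periodic a₀ a) (length (v ++ w))

    γ-periodic : Periodic P γ
    γ-periodic = periodic-*ʳ {length (v ++ w)} (cycle-periodic a₀ (a ++ w)) (length v)

    γ≈v⋯w⋯γ : γ ≈w (v ⋯ (w ⋯ γ))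
    γ≈v⋯w⋯γ n = trans (cycle-unfold a₀ (a ++ w) n) (⋯-++ v w γ n)

    ¬ultEq : ¬ UltEq (u ⋯ α) (u ⋯ γ)
    ¬ultEq ultEq = ¬α≈w⋯α (⋯-cancelˡ v v⋯α≈v⋯w⋯α)
      where
      α≈γ : α ≈w γ
      α≈γ = periodic-ultEq⇒≈ α-periodic γ-periodic (ultEq-⋯⁻ u ultEq)

      v⋯α≈v⋯w⋯α : (v ⋯ α) ≈w (v ⋯ (w ⋯ α))
      v⋯α≈v⋯w⋯α n = begin
        (v ⋯ α) n         ≡⟨ cycle-unfold a₀ a n ⟨
        α n               ≡⟨ α≈γ n ⟩
        γ n               ≡⟨ γ≈v⋯w⋯γ n ⟩
        (v ⋯ (w ⋯ γ)) n   ≡⟨ ⋯-cong v (⋯-cong w α≈γ) n ⟨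
        (v ⋯ (w ⋯ α)) n   ∎

    -- v^ω has a 1 since u v^ω ∈ L; taken inside v, the same 1 occurs in (vw)^ω.
    ¬finite : ¬ FiniteSuppInter (u ⋯ α) (u ⋯ γ)
    ¬finite = periodic-sharedOne α-periodic γ-periodic j αj γj ∘ finiteSuppInter-⋯⁻ u
      where
      α-one : ∃ λ k → α k ≡ true
      α-one = one-beyond-prefix u (L-onesUnbounded (H⊆L _ x∈H) (length u))

      j = proj₁ α-one % length v

      αj : α j ≡ true
      αj = trans (sym (periodic-% (cycle-periodic a₀ a) (proj₁ α-one))) (proj₂ α-one)

      γj : γ j ≡ true
      γj = begin
        γ j                ≡⟨ γ≈v⋯w⋯γ j ⟩
        (v ⋯ (w ⋯ γ)) j    ≡⟨ ⋯-inside v (w ⋯ γ) α (m%n<n (proj₁ α-one) (length v)) ⟩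
        (v ⋯ α) j          ≡⟨ cycle-unfold a₀ a j ⟨
        α j                ≡⟨ αj ⟩
        true               ∎

  ¬E2-homogeneous : ¬ TwoSetsIn H E2
  ¬E2-homogeneous hom = hom x y x∈H y∈H x≉y (inj₂ (ultEq-⋯ (u ++ v ++ w) (u ++ w ++ v) α same-length))
    where
    x y : Word
    x = (u ++ v ++ w) ⋯ α
    y = (u ++ w ++ v) ⋯ α

    regroup : ∀ c d → ((u ++ c ++ d) ⋯ α) ≈w (u ⋯ (c ⋯ (d ⋯ α)))
    regroup c d n = trans (⋯-++ u (c ++ d) α n) (⋯-cong u (⋯-++ c d α) n)

    x∈H : H x
    x∈H = ∈H (omegaPow-⋯ {V} a∈V (omegaPow-⋯ {V} b∈V (omegaPow-cycle {V} a∈V))) (regroup v w)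

    y∈H : H y
    y∈H = ∈H (omegaPow-⋯ {V} b∈V (omegaPow-⋯ {V} a∈V (omegaPow-cycle {V} a∈V))) (regroup w v)

    same-length : length (u ++ v ++ w) ≡ length (u ++ w ++ v)
    same-length = begin
      length (u ++ v ++ w)            ≡⟨ length-++ u ⟩
      length u + length (v ++ w)      ≡⟨ cong (length u +_) (length-++-comm v w) ⟩
      length u + length (w ++ v)      ≡⟨ length-++ u ⟨
      length (u ++ w ++ v)            ∎

    -- If v w v^ω = w v v^ω = w v^ω, then w v^ω is a fixed point of v ⋯_, hence equals v^ω.
    x≉y : ¬ x ≈w y
    x≉y x≈y = ¬α≈w⋯α (λ n → sym (fixpoint-unique a₀ a w⋯α≈v⋯w⋯α (cycle-unfold a₀ a) n))
      where
      v⋯w⋯α≈w⋯v⋯α : (v ⋯ (w ⋯ α)) ≈w (w ⋯ (v ⋯ α))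
      v⋯w⋯α≈w⋯v⋯α = ⋯-cancelˡ u (λ n → trans (sym (regroup v w n)) (trans (x≈y n) (regroup w v n)))

      w⋯α≈v⋯w⋯α : (w ⋯ α) ≈w (v ⋯ (w ⋯ α))
      w⋯α≈v⋯w⋯α n = trans (⋯-cong w (cycle-unfold a₀ a) n) (sym (v⋯w⋯α≈w⋯v⋯α n))

lemma3p12 : (H : Word → Set) → (∀ x → H x → L x) → LANGstar H → Uncountable H →
            ¬ TwoSetsIn H E1 × ¬ TwoSetsIn H E2
lemma3p12 H H⊆L (n , U , V , H⇔⋃) uncountable =
    (λ hom → uncountable (degenerate⇒enumerable H⊆⋃ λ i nd → ¬E1-homogeneous {V = V i} (⋃⊆H i) nd H⊆L hom))
  , (λ hom → uncountable (degenerate⇒enumerable H⊆⋃ λ i nd → ¬E2-homogeneous {V = V i} (⋃⊆H i) nd hom))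
  where
  H⊆⋃ : ∀ x → H x → Σ (Fin n) λ i → ConcOmega (U i) (V i) x
  H⊆⋃ x = proj₁ (H⇔⋃ x)

  ⋃⊆H : ∀ i {x} → ConcOmega (U i) (V i) x → H x
  ⋃⊆H i {x} x∈ = proj₂ (H⇔⋃ x) (i , x∈)
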